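{- Let $X$ be a set and $\mathcal F\subseteq\mathfrak P(X)$ nonempty. If the token system $(\mathcal F,\mathcal G_{\mathcal F})$ is a medium, then $\mathcal F\subseteq[S]$ for some $S\in\mathfrak P(X)$.
   Context: For $x\in X$, $\gamma_x,\tilde\gamma_x:\mathfrak P(X)\to\mathfrak P(X)$ are $S\gamma_x=S\cup\{x\}$, $S\tilde\gamma_x=S\setminus\{x\}$. For such $\tau$, its reduction $\tau_{\mathcal F}:\mathcal F\to\mathcal F$ is $S\tau_{\mathcal F}=S\tau$ if $S\tau\in\mathcal F$, else $S$; $\mathcal G_{\mathcal F}$ is the set of all distinct reductions of the $\gamma_x,\tilde\gamma_x$ different from the identity of $\mathcal F$. For $P,Q\subseteq X$, $P\sim Q$ iff $P\Delta Q$ is finite; $[S]$ is the $\sim$-class of $S$. A token system is a pair $(\mathcal S,\mathcal T)$ with $|\mathcal S|>1$ and $\mathcal T$ a set of non-identity maps $\mathcal S\to\mathcal S$ (tokens); $S\tau=\tau(S)$, $S\tau_1\cdots\tau_n=\tau_n(\cdots\tau_1(S)\cdots)$. $\tau'$ is a reverse of $\tau$ if for distinct $S,V$: $S\tau=V\iff V\tau'=S$. A message $\mathbf m=\tau_1\cdots\tau_n$ produces $V$ from $S$ if $S\mathbf m=V$; it is ineffective for $S$ if $S\mathbf m=S$; stepwise effective for $S$ if $S\tau_1\cdots\tau_k\ne S\tau_1\cdots\tau_{k-1}$ for $1\le k\le n$; consistent if it does not contain a token and a reverse of it; straight for $S$ if consistent and stepwise effective for $S$; vacuous if its indices split into pairs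 $\{i,j\}$ with one of $\tau_i,\tau_j$ a reverse of the other; $\mathbf m,\mathbf n$ jointly consistent if $\mathbf{mn}$ is consistent. A medium satisfies: [M1] each token $\tau$ has a unique reverse $\tilde\tau$; [M2] distinct states $S,V$ admit a consistent message transforming $S$ into $V$; [M3] a message stepwise effective for a state is ineffective for it iff vacuous; [M4] two straight messages producing the same state are jointly consistent. -}

module Defs where

open import Level using (0ℓ)
open import Data.Bool using (Bool; true; false; if_then_else_)
open import Data.Product using (Σ; ∃; _×_; _,_; proj₁; proj₂)
open import Data.Unit using (⊤)
import Data.Sum
open import Data.List using (List; []; _∷_; _++_; foldl)
open import Data.List.Membership.Propositional using (_∈_)
open import Data.List.Relation.Binary.Permutation.Propositional using (_↭_)
open import Relation.Binary.PropositionalEquality using (_≡_; _≢_)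
open import Relation.Nullary using (¬_; Dec; yes; no)
open import Function.Bundles using (_⇔_)
open import Axiom.ExcludedMiddle using (ExcludedMiddle)

-- Generic token systems and media (Falmagne–Ovchinnikov).
-- States form a type with an equivalence _≈_ (state equality);
-- tokens form a type with an equality _≋_; act s τ is  s τ.

module TokenSystem {St : Set} (_≈_ : St → St → Set)
                   {Tok : Set} (_≋_ : Tok → Tok → Set)
                   (act : St → Tok → St) where

  Message : Set
  Message = List Tok

  run : St → Message → St
  run = foldl act

  IsReverse : Tok → Tok → Set
  IsReverse τ τ' = ∀ s v → ¬ (s ≈ v) → (act s τ ≈ v ⇔ act v τ' ≈ s)

  Ineffective : St → Message → Set
  Ineffective s m = run s m ≈ s

  StepwiseEffective : St → Message → Set
  StepwiseEffective s []      = ⊤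
  StepwiseEffective s (τ ∷ m) = ¬ (act s τ ≈ s) × StepwiseEffective (act s τ) m

  Consistent : Message → Set
  Consistent m = ¬ (Σ Tok λ τ → Σ Tok λ τ' → τ ∈ m × τ' ∈ m × IsReverse τ τ')

  Straight : St → Message → Set
  Straight s m = Consistent m × StepwiseEffective s m

  data Paired : Message → Set where
    []  : Paired []
    _∷_ : ∀ {τ τ' m} → (IsReverse τ τ' Data.Sum.⊎ IsReverse τ' τ) → Paired m → Paired (τ ∷ τ' ∷ m)

  -- indices split into pairs {i,j} with one of τᵢ, τⱼ a reverse of the other
  Vacuous : Message → Set
  Vacuous m = Σ Message λ l → Paired l × (m ↭ l)

  JointlyConsistent : Message → Message → Set
  JointlyConsistent m n = Consistent (m ++ n)

  record IsMedium : Set where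
    field
      -- token system: more than one state (tokens are non-identity by construction)
      twoStates : Σ St λ s → Σ St λ v → ¬ (s ≈ v)
      M1 : ∀ τ → Σ Tok λ τ' → IsReverse τ τ' × (∀ τ'' → IsReverse τ τ'' → τ'' ≋ τ')
      M2 : ∀ s v → ¬ (s ≈ v) → Σ Message λ m → Consistent m × run s m ≈ v
      M3 : ∀ s m → StepwiseEffective s m → (Ineffective s m ⇔ Vacuous m)
      M4 : ∀ s s' v m n → Straight s m → Straight s' n →
           run s m ≈ v → run s' n ≈ v → JointlyConsistent m n

-- Subsets of X as characteristic functions (classically 𝔓(X) ≅ X → Bool),
-- with extensional (pointwise) equality.

Subset : Set → Set
Subset X = X → Bool

_≐_ : {X : Set} → Subset X → Subset X → Set
S ≐ V = ∀ x → S x ≡ V x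

Family : Set → Set₁
Family X = Subset X → Set

RespectsEq : {X : Set} → Family X → Set
RespectsEq F = ∀ {S V} → S ≐ V → F S → F V

module Reduction (lem : ExcludedMiddle 0ℓ) {X : Set} (F : Family X) where

  -- γ_x (b = true) sends S to S ∪ {x};  γ̃_x (b = false) sends S to S ∖ {x}
  γ : X → Bool → Subset X → Subset X
  γ x b S y with lem {y ≡ x}
  ... | yes _ = b
  ... | no  _ = S y

  State : Set
  State = Σ (Subset X) F

  _≈_ : State → State → Set
  s ≈ v = proj₁ s ≐ proj₁ v

  red : X × Bool → State → State
  red (x , b) (S , p) with lem {F (γ x b S)}
  ... | yes q = (γ x b S , q)
  ... | no  _ = (S , p)

  -- 𝓖_𝓕: reductions different from the identity of 𝓕 (identified extensionally)
  Token : Set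
  Token = Σ (X × Bool) λ i → ¬ (∀ s → red i s ≈ s)

  _≋_ : Token → Token → Set
  τ ≋ τ' = ∀ s → red (proj₁ τ) s ≈ red (proj₁ τ') s

  act : State → Token → State
  act s τ = red (proj₁ τ) s

  open TokenSystem _≈_ _≋_ act public

Finite : {X : Set} → (X → Set) → Set
Finite {X} A = Σ (List X) λ xs → ∀ x → A x → x ∈ xs

_∼_ : {X : Set} → Subset X → Subset X → Set
P ∼ Q = Finite (λ x → P x ≢ Q x)

_⊆Class_ : {X : Set} → Family X → Subset X → Set
F ⊆Class S = ∀ T → F T → T ∼ S

{-# OPTIONS --safe #-}
module Submission where

-- A token of 𝓖_𝓕 is the reduction of some γ_x or γ̃_x, so it changes a state
-- at most at the point x. Hence a message changes a state only at the finitely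
-- many points of its tokens, and since by [M2] every member of 𝓕 is produced
-- from a fixed S ∈ 𝓕 by some message, it differs from S on a finite set.

open import Defs
open import Level using (0ℓ)
open import Axiom.ExcludedMiddle using (ExcludedMiddle)
open import Data.Product using (Σ; _,_; proj₁)
open import Data.List using (List; []; _∷_; map)
open import Data.List.Membership.Propositional using (_∈_)
open import Data.List.Relation.Unary.Any using (here; there)
open import Relation.Binary.PropositionalEquality using (_≡_; _≢_; refl; sym; trans)
open import Relation.Nullary using (yes; no; contradiction)

module ReductionSupport (lem : ExcludedMiddle 0ℓ) {X : Set} (F : Family X) where
  open Reduction lem F

  γ-fixes-≢ : ∀ {x y} b (S : Subset X) → x ≢ y → γ y b S x ≡ S x
  γ-fixes-≢ {x} {y} b S x≢y with lem {x ≡ y}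
  ... | yes x≡y = contradiction x≡y x≢y
  ... | no  _   = refl

  red-fixes-≢ : ∀ {x y} b (s : State) → x ≢ y → proj₁ (red (y , b) s) x ≡ proj₁ s x
  red-fixes-≢ {y = y} b (S , _) x≢y with lem {F (γ y b S)}
  ... | yes _ = γ-fixes-≢ b S x≢y
  ... | no  _ = refl

  points : Message → List X
  points = map (λ τ → proj₁ (proj₁ τ))

  run-changes-only-points : ∀ s m {x} → proj₁ (run s m) x ≢ proj₁ s x → x ∈ points m
  run-changes-only-points s [] changed = contradiction refl changed
  run-changes-only-points s (τ@((y , b) , _) ∷ m) {x} changed with lem {x ≡ y}
  ... | yes x≡y = here x≡y
  ... | no  x≢y = there (run-changes-only-points (act s τ) m
                           λ same → changed (trans same (red-fixes-≢ b s x≢y)))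

  record Reachable (s t : State) : Set where
    constructor reach
    field
      message : Message
      reaches : run s message ≈ t

  reachable⇒∼ : ∀ {s t} → Reachable s t → proj₁ t ∼ proj₁ s
  reachable⇒∼ {s} (reach m run≈t) =
    points m , λ x t≢s → run-changes-only-points s m λ same → t≢s (trans (sym (run≈t x)) same)

  medium⇒reachable : IsMedium → ∀ s t → Reachable s t
  medium⇒reachable medium s t with lem {s ≈ t}
  ... | yes s≈t = reach [] s≈t
  ... | no  s≉t = let (m , _ , run≈t) = IsMedium.M2 medium s t s≉t in reach m run≈t

mainTheorem11 : (lem : ExcludedMiddle 0ℓ) (X : Set) (F : Family X) → RespectsEq F →
                Σ (Subset X) F → Reduction.IsMedium lem F →
                Σ (Subset X) λ S → F ⊆Class S
mainTheorem11 lem X F _ s@(S , _) medium =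
  S , λ T T∈F → reachable⇒∼ (medium⇒reachable medium s (T , T∈F))
  where open ReductionSupport lem F
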